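{- If $A$ and $B$ are finite distributive lattices that are not double diamond-like, then the product lattice $A\times B$ is not double diamond-like.
   Context: For a lattice $L$, $J(L)$ denotes the partially ordered set of nonzero join-irreducible elements of $L$. A finite distributive lattice $L$ is double diamond-like (dd-like) if in the poset $J(L)$ there are two incomparable elements that have at least two distinct minimal upper bounds in $J(L)$. $A\times B$ carries the componentwise order. -}

module Defs where

open import Level using (Level; _⊔_)
open import Data.Fin using (Fin)
open import Data.Product using (Σ; ∃; _×_; _,_; proj₁; proj₂)
open import Data.Product.Relation.Binary.Pointwise.NonDependent
  using (Pointwise; ×-isPartialOrder)
open import Data.Sum using (_⊎_)
open import Relation.Nullary using (¬_)
open import Relation.Binary.PropositionalEquality using (_≡_)
open import Relation.Binary.Lattice.Bundles using (DistributiveLattice)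

private
  variable
    c₁ c₂ ℓ₁ ℓ₂ ℓ₃ ℓ₄ : Level

module _ {c ℓ₁ ℓ₂} (L : DistributiveLattice c ℓ₁ ℓ₂) where
  open DistributiveLattice L

  Finite : Set (c ⊔ ℓ₁)
  Finite = Σ _ λ n → Σ (Fin n → Carrier) λ f →
             (∀ x → ∃ λ i → f i ≈ x) × (∀ i j → f i ≈ f j → i ≡ j)

  JoinIrr : Carrier → Set (c ⊔ ℓ₁ ⊔ ℓ₂)
  JoinIrr j = ¬ (∀ x → j ≤ x) × (∀ a b → j ≈ a ∨ b → j ≈ a ⊎ j ≈ b)

  MinUpperBoundInJ : Carrier → Carrier → Carrier → Set (c ⊔ ℓ₁ ⊔ ℓ₂)
  MinUpperBoundInJ x y u =
    JoinIrr u × x ≤ u × y ≤ u ×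
    (∀ v → JoinIrr v → x ≤ v → y ≤ v → v ≤ u → v ≈ u)

  DDLike : Set (c ⊔ ℓ₁ ⊔ ℓ₂)
  DDLike = Σ Carrier λ x → Σ Carrier λ y → Σ Carrier λ u₁ → Σ Carrier λ u₂ →
    JoinIrr x × JoinIrr y × ¬ x ≤ y × ¬ y ≤ x ×
    MinUpperBoundInJ x y u₁ × MinUpperBoundInJ x y u₂ × ¬ u₁ ≈ u₂

_×ᴰᴸ_ : DistributiveLattice c₁ ℓ₁ ℓ₂ → DistributiveLattice c₂ ℓ₃ ℓ₄ →
        DistributiveLattice (c₁ ⊔ c₂) (ℓ₁ ⊔ ℓ₃) (ℓ₂ ⊔ ℓ₄)
A ×ᴰᴸ B = record
  { Carrier = A.Carrier × B.Carrier
  ; _≈_ = Pointwise A._≈_ B._≈_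
  ; _≤_ = Pointwise A._≤_ B._≤_
  ; _∨_ = λ p q → (proj₁ p A.∨ proj₁ q) , (proj₂ p B.∨ proj₂ q)
  ; _∧_ = λ p q → (proj₁ p A.∧ proj₁ q) , (proj₂ p B.∧ proj₂ q)
  ; isDistributiveLattice = record
    { isLattice = record
      { isPartialOrder = ×-isPartialOrder A.isPartialOrder B.isPartialOrder
      ; supremum = λ p q →
          let (a₁ , a₂ , a₃) = A.supremum (proj₁ p) (proj₁ q)
              (b₁ , b₂ , b₃) = B.supremum (proj₂ p) (proj₂ q)
          in (a₁ , b₁) , (a₂ , b₂) ,
             λ r pr qr → a₃ (proj₁ r) (proj₁ pr) (proj₁ qr) ,
                         b₃ (proj₂ r) (proj₂ pr) (proj₂ qr)
      ; infimum = λ p q →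
          let (a₁ , a₂ , a₃) = A.infimum (proj₁ p) (proj₁ q)
              (b₁ , b₂ , b₃) = B.infimum (proj₂ p) (proj₂ q)
          in (a₁ , b₁) , (a₂ , b₂) ,
             λ r pr qr → a₃ (proj₁ r) (proj₁ pr) (proj₁ qr) ,
                         b₃ (proj₂ r) (proj₂ pr) (proj₂ qr)
      }
    ; ∧-distribˡ-∨ = λ p q r →
        A.∧-distribˡ-∨ (proj₁ p) (proj₁ q) (proj₁ r) ,
        B.∧-distribˡ-∨ (proj₂ p) (proj₂ q) (proj₂ r)
    }
  }
  where
    module A = DistributiveLattice A
    module B = DistributiveLattice B

module Submission where

-- A join-irreducible element of a product A × B of lattices with least
-- elements a₀, b₀ lies on one of the two axes: p = (p₁ , b₀) ∨ (a₀ , p₂),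
-- so p equals one of these two joinands.  On the left axis the map
-- a ↦ (a , b₀) identifies J(A) with the join-irreducibles (p₁ , b₀), and
-- every join-irreducible above a left-axis element is again on the left
-- axis (otherwise it would lie below (a₀ , b₀), the least element).
--
-- Hence a double-diamond configuration x, y, u₁, u₂ in J(A × B) either
-- has x and y on different axes -- impossible, since a common upper bound
-- in J(A × B) would have to lie on both axes -- or lies entirely on one
-- axis, where it projects to a double-diamond configuration in A (left
-- axis) or, after swapping the factors, in B (right axis).

open import Defs
open import Level using (Level)
open import Relation.Nullary using (¬_)
open import Relation.Binary.Lattice.Bundles using (DistributiveLattice)
import Relation.Binary.Lattice.Properties.JoinSemilattice as JoinSemilatticeProperties
open import Data.Nat using (ℕ; zero; suc)
open import Data.Fin using (Fin; zero; suc)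
open import Data.Product using (Σ; _,_; proj₁; proj₂; swap)
open import Data.Sum using (_⊎_; inj₁; inj₂)
import Data.Sum as Sum
open import Data.Empty using (⊥; ⊥-elim)

private
  variable
    c₁ c₂ ℓ₁ ℓ₂ ℓ₃ ℓ₄ : Level

module LeastElement {c ℓ ℓ′} (L : DistributiveLattice c ℓ ℓ′) where
  open DistributiveLattice L

  meetOf : (n : ℕ) → (Fin n → Carrier) → Carrier → Carrier
  meetOf zero    f e = e
  meetOf (suc n) f e = f zero ∧ meetOf n (λ i → f (suc i)) e

  meetOf-≤ : ∀ n (f : Fin n → Carrier) e i → meetOf n f e ≤ f i
  meetOf-≤ (suc n) f e zero    = x∧y≤x _ _
  meetOf-≤ (suc n) f e (suc i) =
    trans (x∧y≤y _ _) (meetOf-≤ n (λ j → f (suc j)) e i)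

  least : Finite L → Carrier → Σ Carrier λ o → ∀ x → o ≤ x
  least (n , f , onto , _) e = meetOf n f e , λ x →
    let (i , fi≈x) = onto x in trans (meetOf-≤ n f e i) (reflexive fi≈x)

module JoinWithLeast {c ℓ ℓ′} (L : DistributiveLattice c ℓ ℓ′)
    {o : DistributiveLattice.Carrier L}
    (o-least : ∀ x → DistributiveLattice._≤_ L o x) where
  open DistributiveLattice L
  open JoinSemilatticeProperties joinSemilattice using (x≤y⇒x∨y≈y; ∨-comm)

  ∨-identityˡ : ∀ x → o ∨ x ≈ x
  ∨-identityˡ x = x≤y⇒x∨y≈y (o-least x)

  ∨-identityʳ : ∀ x → x ∨ o ≈ x
  ∨-identityʳ x = Eq.trans (∨-comm x o) (∨-identityˡ x)

  least-joinˡ : ∀ {x y} → o ≈ x ∨ y → o ≈ x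
  least-joinˡ {x} {y} e = antisym (o-least x) (trans (x≤x∨y x y) (reflexive (Eq.sym e)))

  least-joinʳ : ∀ {x y} → o ≈ x ∨ y → o ≈ y
  least-joinʳ {x} {y} e = antisym (o-least y) (trans (y≤x∨y x y) (reflexive (Eq.sym e)))

-- On the product
-- order and equality, swap acts by swapping the component proofs.
swap-JoinIrr : (A : DistributiveLattice c₁ ℓ₁ ℓ₂) (B : DistributiveLattice c₂ ℓ₃ ℓ₄) →
  ∀ p → JoinIrr (A ×ᴰᴸ B) p → JoinIrr (B ×ᴰᴸ A) (swap p)
swap-JoinIrr A B p (nonLeast , irreducible) =
  (λ below → nonLeast λ q → swap (below (swap q))) ,
  λ a b e → Sum.map swap swap (irreducible (swap a) (swap b) (swap e))

swap-MinUpperBoundInJ :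
  (A : DistributiveLattice c₁ ℓ₁ ℓ₂) (B : DistributiveLattice c₂ ℓ₃ ℓ₄) →
  ∀ {x y u} → MinUpperBoundInJ (A ×ᴰᴸ B) x y u →
  MinUpperBoundInJ (B ×ᴰᴸ A) (swap x) (swap y) (swap u)
swap-MinUpperBoundInJ A B {u = u} (ju , x≤u , y≤u , minimal) =
  swap-JoinIrr A B u ju , swap x≤u , swap y≤u ,
  λ v jv x≤v y≤v v≤u →
    swap (minimal (swap v) (swap-JoinIrr B A v jv) (swap x≤v) (swap y≤v) (swap v≤u))

swap-DDLike : (A : DistributiveLattice c₁ ℓ₁ ℓ₂) (B : DistributiveLattice c₂ ℓ₃ ℓ₄) →
  DDLike (A ×ᴰᴸ B) → DDLike (B ×ᴰᴸ A)
swap-DDLike A B (x , y , u₁ , u₂ , jx , jy , x≰y , y≰x , m₁ , m₂ , u₁≉u₂) =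
  swap x , swap y , swap u₁ , swap u₂ ,
  swap-JoinIrr A B x jx , swap-JoinIrr A B y jy ,
  (λ le → x≰y (swap le)) , (λ le → y≰x (swap le)) ,
  swap-MinUpperBoundInJ A B m₁ , swap-MinUpperBoundInJ A B m₂ ,
  λ e → u₁≉u₂ (swap e)

module Axes (A : DistributiveLattice c₁ ℓ₁ ℓ₂) (B : DistributiveLattice c₂ ℓ₃ ℓ₄)
    {a₀ : DistributiveLattice.Carrier A} (a₀-least : ∀ a → DistributiveLattice._≤_ A a₀ a)
    {b₀ : DistributiveLattice.Carrier B} (b₀-least : ∀ b → DistributiveLattice._≤_ B b₀ b)
    where
  private
    module A = DistributiveLattice A
    module B = DistributiveLattice B
    module A₀ = JoinWithLeast A a₀-least
    module B₀ = JoinWithLeast B b₀-least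
    P = A ×ᴰᴸ B
    module P = DistributiveLattice P

  OnLeftAxis : P.Carrier → Set ℓ₃
  OnLeftAxis p = proj₂ p B.≈ b₀

  OnRightAxis : P.Carrier → Set ℓ₁
  OnRightAxis p = proj₁ p A.≈ a₀

  axis-decomposition : ∀ p → p P.≈ (proj₁ p , b₀) P.∨ (a₀ , proj₂ p)
  axis-decomposition (p₁ , p₂) = A.Eq.sym (A₀.∨-identityʳ p₁) , B.Eq.sym (B₀.∨-identityˡ p₂)

  joinIrr-on-axis : ∀ {p} → JoinIrr P p → OnLeftAxis p ⊎ OnRightAxis p
  joinIrr-on-axis {p} (_ , irreducible) =
    Sum.map proj₂ proj₁ (irreducible _ _ (axis-decomposition p))

  joinIrr-not-least : ∀ {p} → JoinIrr P p → proj₁ p A.≤ a₀ → proj₂ p B.≤ b₀ → ⊥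
  joinIrr-not-least (nonLeast , _) p₁≤a₀ p₂≤b₀ =
    nonLeast λ q → A.trans p₁≤a₀ (a₀-least (proj₁ q)) , B.trans p₂≤b₀ (b₀-least (proj₂ q))

  -- A join-irreducible above a join-irreducible on the left axis is on
  -- the left axis too: were it on the right axis, x would lie below the
  -- least element.
  above-left-axis : ∀ {x u} → JoinIrr P x → OnLeftAxis x → JoinIrr P u → x P.≤ u →
    OnLeftAxis u
  above-left-axis jx xL ju (x₁≤u₁ , _) with joinIrr-on-axis ju
  ... | inj₁ uL = uL
  ... | inj₂ uR = ⊥-elim (joinIrr-not-least jx (A.trans x₁≤u₁ (A.reflexive uR)) (B.reflexive xL))

  -- Join-irreducibles on different axes have no common upper bound in J(P):
  -- it would lie on the left axis, putting y below the least element.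
  no-common-bound : ∀ {x y u} → JoinIrr P x → JoinIrr P y →
    OnLeftAxis x → OnRightAxis y → JoinIrr P u → x P.≤ u → y P.≤ u → ⊥
  no-common-bound jx jy xL yR ju x≤u (_ , y₂≤u₂) =
    joinIrr-not-least jy (A.reflexive yR) (B.trans y₂≤u₂ (B.reflexive (above-left-axis jx xL ju x≤u)))

  joinIrr-left : ∀ {p} → JoinIrr P p → OnLeftAxis p → JoinIrr A (proj₁ p)
  joinIrr-left {p₁ , p₂} (nonLeast , irreducible) pL =
    (λ below → nonLeast λ q → below (proj₁ q) , B.trans (B.reflexive pL) (b₀-least (proj₂ q))) ,
    λ a b p₁≈a∨b → Sum.map proj₁ proj₁
      (irreducible (a , p₂) (b , p₂) (p₁≈a∨b , B.Eq.sym (∨-idempotent p₂)))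
    where open JoinSemilatticeProperties B.joinSemilattice using (∨-idempotent)

  left-joinIrr : ∀ {a} → JoinIrr A a → JoinIrr P (a , b₀)
  left-joinIrr (nonLeast , irreducible) =
    (λ below → nonLeast λ a → proj₁ (below (a , b₀))) ,
    λ { (q₁ , q₂) (r₁ , r₂) (a≈q₁∨r₁ , b₀≈q₂∨r₂) → Sum.map
          (λ a≈q₁ → a≈q₁ , B₀.least-joinˡ b₀≈q₂∨r₂)
          (λ a≈r₁ → a≈r₁ , B₀.least-joinʳ b₀≈q₂∨r₂)
          (irreducible q₁ r₁ a≈q₁∨r₁) }

  minUpperBound-left : ∀ {x y u} → JoinIrr P x → OnLeftAxis x → OnLeftAxis y →
    MinUpperBoundInJ P x y u → MinUpperBoundInJ A (proj₁ x) (proj₁ y) (proj₁ u)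
  minUpperBound-left {u = u} jx xL yL (ju , x≤u , y≤u , minimal) =
    joinIrr-left ju (above-left-axis jx xL ju x≤u) , proj₁ x≤u , proj₁ y≤u ,
    λ v jv x₁≤v y₁≤v v≤u₁ → proj₁ (minimal (v , b₀) (left-joinIrr jv)
      (x₁≤v , B.reflexive xL) (y₁≤v , B.reflexive yL) (v≤u₁ , b₀-least (proj₂ u)))

  ddLike-left : (d : DDLike P) → OnLeftAxis (proj₁ d) → OnLeftAxis (proj₁ (proj₂ d)) →
    DDLike A
  ddLike-left (x , y , u₁ , u₂ , jx , jy , x≰y , y≰x , m₁ , m₂ , u₁≉u₂) xL yL =
    proj₁ x , proj₁ y , proj₁ u₁ , proj₁ u₂ ,
    joinIrr-left jx xL , joinIrr-left jy yL ,
    (λ x₁≤y₁ → x≰y (x₁≤y₁ , B.trans (B.reflexive xL) (b₀-least (proj₂ y)))) ,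
    (λ y₁≤x₁ → y≰x (y₁≤x₁ , B.trans (B.reflexive yL) (b₀-least (proj₂ x)))) ,
    minUpperBound-left jx xL yL m₁ , minUpperBound-left jx xL yL m₂ ,
    λ e → u₁≉u₂ (e , B.Eq.trans (u-on-left m₁) (B.Eq.sym (u-on-left m₂)))
    where
      u-on-left : ∀ {u} → MinUpperBoundInJ P x y u → OnLeftAxis u
      u-on-left (ju , x≤u , _) = above-left-axis jx xL ju x≤u

module ProductNotDDLike (A : DistributiveLattice c₁ ℓ₁ ℓ₂) (B : DistributiveLattice c₂ ℓ₃ ℓ₄)
    {a₀ : DistributiveLattice.Carrier A} (a₀-least : ∀ a → DistributiveLattice._≤_ A a₀ a)
    {b₀ : DistributiveLattice.Carrier B} (b₀-least : ∀ b → DistributiveLattice._≤_ B b₀ b)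
    where
  private
    module AB = Axes A B a₀-least b₀-least
    module BA = Axes B A b₀-least a₀-least

  product-not-ddLike : ¬ DDLike A → ¬ DDLike B → ¬ DDLike (A ×ᴰᴸ B)
  product-not-ddLike notA notB d@(x , y , _ , _ , jx , jy , _ , _ , (ju , x≤u , y≤u , _) , _)
    with AB.joinIrr-on-axis jx | AB.joinIrr-on-axis jy
  ... | inj₁ xL | inj₁ yL = notA (AB.ddLike-left d xL yL)
  ... | inj₂ xR | inj₂ yR = notB (BA.ddLike-left (swap-DDLike A B d) xR yR)
  ... | inj₁ xL | inj₂ yR = AB.no-common-bound jx jy xL yR ju x≤u y≤u
  ... | inj₂ xR | inj₁ yL = AB.no-common-bound jy jx yL xR ju y≤u x≤u

-- Lemma 3.7: a product of finite distributive lattices that are not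
-- dd-like is not dd-like.  Any configuration provides an element, so both
-- factors are nonempty and hence have least elements.
lemma3p7 : ∀ {c₁ c₂ ℓ₁ ℓ₂ ℓ₃ ℓ₄ : Level}
    (A : DistributiveLattice c₁ ℓ₁ ℓ₂) (B : DistributiveLattice c₂ ℓ₃ ℓ₄) →
    Finite A → Finite B → ¬ DDLike A → ¬ DDLike B → ¬ DDLike (A ×ᴰᴸ B)
lemma3p7 A B finA finB notA notB d@((x₁ , x₂) , _) =
  let (_ , a₀-least) = LeastElement.least A finA x₁
      (_ , b₀-least) = LeastElement.least B finB x₂
  in ProductNotDDLike.product-not-ddLike A B a₀-least b₀-least notA notB d
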